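{- Let $n\ge1$, $C\in\mathbb{N}$ and let $a_1,\ldots,a_{3n}$ be nonnegative integers with $\frac{C}{4}<a_i<\frac{C}{2}$ for all $i$ and $\sum_{i=1}^{3n}a_i=nC$. Let $\lambda\ge 1$ be an integer and $$P_\lambda(q)=n q^{\lambda C+1}+\sum_{i=1}^{3n} q^{\lambda C+1+\lambda a_i}+\sum_{i=1}^{3n}(\lambda a_i-1)q^{\lambda C+\lambda a_i+2}.$$ If $T$ is a rooted tree with $Av_T(q)=P_\lambda(q)$, then the root of $T$ has exactly $n$ children, each labeled $\lambda C+1$.
   Context: Let $T$ be a finite tree rooted at a vertex $r$. For a vertex $v$, the maximal subtree rooted at $v$ consists of $v$ and all its descendants; its size is its number of vertices. The vertices of $T$ are labeled as follows: the root is labeled $0$, and a child $v$ of a vertex labeled $\mu$ is labeled $\mu + |\text{maximal subtree rooted at } v|$. The avalanche polynomial of $T$ is $Av_T(q)=\sum_{i\ge 1} p_i q^i$, where $p_i$ is the number of vertices of $T$ labeled $i$. -}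

module Defs where

open import Data.Nat using (ℕ; zero; suc; _+_; _*_; _∸_; _≟_)
open import Data.List using (List; []; _∷_; _++_; length; filter)
open import Data.Vec using (Vec)
import Data.Vec as Vec
open import Relation.Nullary using (yes; no)

data Tree : Set where
  node : List Tree → Tree

children : Tree → List Tree
children (node ts) = ts

mutual
  size : Tree → ℕ
  size (node ts) = suc (sizes ts)

  sizes : List Tree → ℕ
  sizes []       = 0
  sizes (t ∷ ts) = size t + sizes ts

-- label of a child v (with maximal subtree t) of a vertex labeled μ
childLabel : ℕ → Tree → ℕ
childLabel μ t = μ + size t

mutual
  labelsFrom : ℕ → Tree → List ℕ
  labelsFrom μ (node ts) = μ ∷ labelsChildren μ ts

  labelsChildren : ℕ → List Tree → List ℕ
  labelsChildren μ []       = []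
  labelsChildren μ (t ∷ ts) = labelsFrom (childLabel μ t) t ++ labelsChildren μ ts

labels : Tree → List ℕ
labels T = labelsFrom 0 T

countOf : ℕ → List ℕ → ℕ
countOf k xs = length (filter (_≟ k) xs)

-- coefficient of q^i in the avalanche polynomial Av_T(q) = Σ_{i≥1} p_i q^i
avCoeff : Tree → ℕ → ℕ
avCoeff T zero    = 0
avCoeff T (suc i) = countOf (suc i) (labels T)

δ : ℕ → ℕ → ℕ
δ i j with i ≟ j
... | yes _ = 1
... | no  _ = 0

PCoeff : (n C λ' : ℕ) → {m : ℕ} → Vec ℕ m → ℕ → ℕ
PCoeff n C λ' a i =
    n * δ i (λ' * C + 1)
  + Vec.sum (Vec.map (λ aj → δ i (λ' * C + 1 + λ' * aj)) a)
  + Vec.sum (Vec.map (λ aj → (λ' * aj ∸ 1) * δ i (λ' * C + λ' * aj + 2)) a)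

module Submission where

-- Write s = λC + 1, let R be the list of labels of the non-root vertices of
-- T = node ts and ℓs the labels of the root's children (= their subtree sizes).
-- The hypothesis says that every label i occurs in R exactly P_λ[i] times.
--  * P_λ has no coefficient below q^s, so every label in R is at least s.
--  * Labels strictly increase away from the root, so a label s can only sit at
--    a child of the root: the n occurrences of q^s are children of the root.
--  * |R| is the total mass P_λ(1) = n + λ Σ a_i = n + λnC = n·s, and |R| is
--    also the sum of the children's subtree sizes, i.e. Σ ℓs.
--  * A list of numbers ≥ s with exactly n entries equal to s and sum n·s
--    consists of n copies of s.

open import Defs
open import Data.Nat using (ℕ; zero; suc; _+_; _*_; _∸_; _≤_; _<_; _≟_; z≤n; s≤s)
open import Data.Nat.Properties
open import Data.Nat.Solver using (module +-*-Solver)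
open import Data.Nat.ListAction using () renaming (sum to listSum)
open import Data.Fin using (Fin; toℕ)
open import Data.Vec using (Vec; lookup; sum; []; _∷_)
import Data.Vec as Vec
open import Data.Vec.Properties using (map-id)
open import Data.List using (List; []; _∷_; _++_; length; map; filter)
open import Data.List.Properties using (length-++; length-map; filter-++; filter-all; filter-accept; filter-reject)
open import Data.List.Relation.Unary.All using (All; []; _∷_)
import Data.List.Relation.Unary.All as All
open import Data.List.Relation.Unary.All.Properties using (++⁺; ++⁻ˡ; ++⁻ʳ)
open import Data.List.Relation.Unary.Any using (here; there)
open import Data.List.Membership.Propositional using (_∈_)
open import Data.Product using (_×_; _,_)
open import Data.Sum using (inj₁; inj₂)
open import Relation.Nullary using (yes; no; contradiction)
open import Relation.Binary.PropositionalEquality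
open import Algebra.Properties.Semiring.Sum +-*-semiring
  using (sum-syntax; sum-cong-≗; sum-replicate-zero; ∑-distrib-+; ∑-comm; *-distribˡ-sum)

δ-refl : ∀ i → δ i i ≡ 1
δ-refl i with i ≟ i
... | yes _ = refl
... | no i≢i = contradiction refl i≢i

δ-≢ : ∀ {i j} → i ≢ j → δ i j ≡ 0
δ-≢ {i} {j} i≢j with i ≟ j
... | yes i≡j = contradiction i≡j i≢j
... | no _ = refl

δ-sym : ∀ i j → δ i j ≡ δ j i
δ-sym i j with i ≟ j
... | yes refl = sym (δ-refl i)
... | no i≢j = sym (δ-≢ (λ j≡i → i≢j (sym j≡i)))

δ-suc : ∀ i j → δ (suc i) (suc j) ≡ δ i j
δ-suc i j with i ≟ j
... | yes refl = δ-refl (suc i)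
... | no i≢j = δ-≢ (λ si≡sj → i≢j (suc-injective si≡sj))

δ-weight : ∀ x k → δ x k * k ≤ x
δ-weight x k with x ≟ k
... | yes refl = ≤-reflexive (+-identityʳ x)
... | no _ = z≤n

countOf-hit : ∀ x xs → countOf x (x ∷ xs) ≡ suc (countOf x xs)
countOf-hit x xs = cong length (filter-accept (_≟ x) refl)

countOf-miss : ∀ {k x} xs → x ≢ k → countOf k (x ∷ xs) ≡ countOf k xs
countOf-miss {k} xs x≢k = cong length (filter-reject (_≟ k) x≢k)

countOf-∷ : ∀ k x xs → countOf k (x ∷ xs) ≡ δ x k + countOf k xs
countOf-∷ k x xs with x ≟ k
... | yes refl = countOf-hit x xs
... | no x≢k = countOf-miss xs x≢k

countOf-++ : ∀ k xs ys → countOf k (xs ++ ys) ≡ countOf k xs + countOf k ys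
countOf-++ k xs ys = trans (cong length (filter-++ (_≟ k) xs ys)) (length-++ (filter (_≟ k) xs))

countOf-above : ∀ k xs → All (k <_) xs → countOf k xs ≡ 0
countOf-above k [] [] = refl
countOf-above k (x ∷ xs) (k<x ∷ k<xs) = trans (countOf-miss xs (>⇒≢ k<x)) (countOf-above k xs k<xs)

countOf-∈ : ∀ {x xs} → x ∈ xs → 0 < countOf x xs
countOf-∈ {x} {_ ∷ xs} (here refl) = subst (0 <_) (sym (countOf-hit x xs)) (s≤s z≤n)
countOf-∈ {x} {y ∷ xs} (there x∈xs) =
  <-≤-trans (countOf-∈ x∈xs) (≤-trans (m≤n+m _ (δ y x)) (≤-reflexive (sym (countOf-∷ x y xs))))

countOf-const : ∀ k xs → All (_≡ k) xs → countOf k xs ≡ length xs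
countOf-const k xs xs≡k = cong length (filter-all (_≟ k) xs≡k)

lower-bound-from-counts : ∀ s xs → (∀ x → x < s → countOf x xs ≡ 0) → All (s ≤_) xs
lower-bound-from-counts s xs absent = All.tabulate λ {x} x∈xs →
  ≮⇒≥ (λ x<s → >⇒≢ (countOf-∈ x∈xs) (absent x x<s))

countOf*≤sum : ∀ k xs → countOf k xs * k ≤ listSum xs
countOf*≤sum k [] = z≤n
countOf*≤sum k (x ∷ xs) = begin
  countOf k (x ∷ xs) * k        ≡⟨ cong (_* k) (countOf-∷ k x xs) ⟩
  (δ x k + countOf k xs) * k    ≡⟨ *-distribʳ-+ k (δ x k) (countOf k xs) ⟩
  δ x k * k + countOf k xs * k  ≤⟨ +-mono-≤ (δ-weight x k) (countOf*≤sum k xs) ⟩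
  x + listSum xs                ∎
  where open ≤-Reasoning

all-equal-if-sum-tight : ∀ k xs → All (k ≤_) xs → listSum xs ≤ countOf k xs * k → All (_≡ k) xs
all-equal-if-sum-tight k [] [] _ = []
all-equal-if-sum-tight k (x ∷ xs) (k≤x ∷ k≤xs) tight with m≤n⇒m<n∨m≡n k≤x
... | inj₂ refl = refl ∷ all-equal-if-sum-tight k xs k≤xs
                           (+-cancelˡ-≤ k _ _ (subst (λ c → k + listSum xs ≤ c * k) (countOf-hit k xs) tight))
... | inj₁ k<x = contradiction x≤0 (<⇒≱ (≤-<-trans z≤n k<x))
  where
  x≤0 : x ≤ 0
  x≤0 = +-cancelʳ-≤ (listSum xs) x 0 (begin
    x + listSum xs          ≤⟨ tight ⟩
    countOf k (x ∷ xs) * k  ≡⟨ cong (_* k) (countOf-miss xs (>⇒≢ k<x)) ⟩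
    countOf k xs * k        ≤⟨ countOf*≤sum k xs ⟩
    listSum xs              ∎)
    where open ≤-Reasoning

∈⇒≤sum : ∀ {x xs} → x ∈ xs → x ≤ listSum xs
∈⇒≤sum {xs = _ ∷ xs} (here refl) = m≤m+n _ (listSum xs)
∈⇒≤sum {xs = y ∷ _} (there x∈xs) = ≤-trans (∈⇒≤sum x∈xs) (m≤n+m _ y)

∑-vanish : ∀ M (f : Fin M → ℕ) → (∀ i → f i ≡ 0) → ∑[ i < M ] f i ≡ 0
∑-vanish M f f≡0 = trans (sum-cong-≗ {M} f≡0) (sum-replicate-zero M)

∑-δ : ∀ M e → e < M → ∑[ i < M ] δ (toℕ i) e ≡ 1
∑-δ (suc M) zero    _ = cong suc (∑-vanish M _ (λ i → refl))
∑-δ (suc M) (suc e) (s≤s e<M) = trans (sum-cong-≗ {M} (λ i → δ-suc (toℕ i) e)) (∑-δ M e e<M)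

∑-countOf : ∀ M xs → All (_< M) xs → ∑[ i < M ] countOf (toℕ i) xs ≡ length xs
∑-countOf M [] [] = sum-replicate-zero M
∑-countOf M (x ∷ xs) (x<M ∷ xs<M) = begin
  ∑[ i < M ] countOf (toℕ i) (x ∷ xs)                          ≡⟨ sum-cong-≗ {M} (λ i → countOf-∷ (toℕ i) x xs) ⟩
  ∑[ i < M ] (δ x (toℕ i) + countOf (toℕ i) xs)               ≡⟨ ∑-distrib-+ {M} (λ i → δ x (toℕ i)) (λ i → countOf (toℕ i) xs) ⟩
  (∑[ i < M ] δ x (toℕ i)) + (∑[ i < M ] countOf (toℕ i) xs)  ≡⟨ cong₂ _+_ x-once (∑-countOf M xs xs<M) ⟩
  suc (length xs)                                               ∎
  where
  open ≡-Reasoning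
  x-once : ∑[ i < M ] δ x (toℕ i) ≡ 1
  x-once = trans (sum-cong-≗ {M} (λ i → δ-sym x (toℕ i))) (∑-δ M x x<M)

sum-map≡∑ : ∀ {m} (f : ℕ → ℕ) (v : Vec ℕ m) → sum (Vec.map f v) ≡ ∑[ j < m ] f (lookup v j)
sum-map≡∑ f [] = refl
sum-map≡∑ f (x ∷ v) = cong (f x +_) (sum-map≡∑ f v)

sum-map-vanish : ∀ {m} (f : ℕ → ℕ) (v : Vec ℕ m) → (∀ j → f (lookup v j) ≡ 0) → sum (Vec.map f v) ≡ 0
sum-map-vanish {m} f v f≡0 = trans (sum-map≡∑ f v) (∑-vanish m _ f≡0)

module Coefficients (n C λ' : ℕ) {m : ℕ} (a : Vec ℕ m) where

  s : ℕ
  s = λ' * C + 1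

  P : ℕ → ℕ
  P = PCoeff n C λ' a

  column : ℕ → ℕ → ℕ
  column i x = δ i (λ' * C + 1 + λ' * x) + (λ' * x ∸ 1) * δ i (λ' * C + λ' * x + 2)

  first<second : ∀ x → λ' * C + 1 + λ' * x < λ' * C + λ' * x + 2
  first<second x = ≤-reflexive (solve 2 (λ c y → con 1 :+ (c :+ con 1 :+ y) := c :+ y :+ con 2) refl (λ' * C) (λ' * x))
    where open +-*-Solver

  s<second : ∀ x → s < λ' * C + λ' * x + 2
  s<second x = ≤-<-trans (m≤m+n s (λ' * x)) (first<second x)

  P-as-∑ : ∀ i → P i ≡ n * δ i s + ∑[ j < m ] column i (lookup a j)
  P-as-∑ i = trans (+-assoc (n * δ i s) _ _) (cong (n * δ i s +_) (begin
    sum (Vec.map first a) + sum (Vec.map second a)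
      ≡⟨ cong₂ _+_ (sum-map≡∑ first a) (sum-map≡∑ second a) ⟩
    (∑[ j < m ] first (lookup a j)) + (∑[ j < m ] second (lookup a j))
      ≡⟨ ∑-distrib-+ {m} (λ j → first (lookup a j)) (λ j → second (lookup a j)) ⟨
    ∑[ j < m ] column i (lookup a j) ∎))
    where
    open ≡-Reasoning
    first second : ℕ → ℕ
    first x = δ i (λ' * C + 1 + λ' * x)
    second x = (λ' * x ∸ 1) * δ i (λ' * C + λ' * x + 2)

  P-below : ∀ i → i < s → P i ≡ 0
  P-below i i<s = cong₂ _+_ (cong₂ _+_ no-root-term no-first-terms) no-second-terms
    where
    no-root-term : n * δ i s ≡ 0
    no-root-term = trans (cong (n *_) (δ-≢ (<⇒≢ i<s))) (*-zeroʳ n)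
    no-first-terms : sum (Vec.map (λ x → δ i (λ' * C + 1 + λ' * x)) a) ≡ 0
    no-first-terms = sum-map-vanish _ a (λ j → δ-≢ (<⇒≢ (<-≤-trans i<s (m≤m+n s _))))
    no-second-terms : sum (Vec.map (λ x → (λ' * x ∸ 1) * δ i (λ' * C + λ' * x + 2)) a) ≡ 0
    no-second-terms = sum-map-vanish _ a λ j →
      trans (cong ((λ' * lookup a j ∸ 1) *_) (δ-≢ (<⇒≢ (<-trans i<s (s<second (lookup a j)))))) (*-zeroʳ (λ' * lookup a j ∸ 1))

  P-at-s : (∀ j → 1 ≤ λ' * lookup a j) → P s ≡ n
  P-at-s λa≥1 = begin
    n * δ s s + sum (Vec.map first a) + sum (Vec.map second a) ≡⟨ cong₂ _+_ (cong₂ _+_ root-term no-first-terms) no-second-terms ⟩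
    n + 0 + 0                                                   ≡⟨ trans (+-identityʳ (n + 0)) (+-identityʳ n) ⟩
    n                                                           ∎
    where
    open ≡-Reasoning
    first second : ℕ → ℕ
    first x = δ s (λ' * C + 1 + λ' * x)
    second x = (λ' * x ∸ 1) * δ s (λ' * C + λ' * x + 2)
    root-term : n * δ s s ≡ n
    root-term = trans (cong (n *_) (δ-refl s)) (*-identityʳ n)
    no-first-terms : sum (Vec.map first a) ≡ 0
    no-first-terms = sum-map-vanish first a (λ j → δ-≢ (<⇒≢ (m<m+n s (λa≥1 j))))
    no-second-terms : sum (Vec.map second a) ≡ 0
    no-second-terms = sum-map-vanish second a λ j →
      trans (cong ((λ' * lookup a j ∸ 1) *_) (δ-≢ (<⇒≢ (s<second (lookup a j))))) (*-zeroʳ (λ' * lookup a j ∸ 1))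

  ∑-column : ∀ M x → 1 ≤ λ' * x → λ' * C + λ' * x + 2 < M → ∑[ i < M ] column (toℕ i) x ≡ λ' * x
  ∑-column M x λx≥1 second<M = begin
    ∑[ i < M ] column (toℕ i) x
      ≡⟨ ∑-distrib-+ {M} (λ i → δ (toℕ i) (λ' * C + 1 + λ' * x)) (λ i → (λ' * x ∸ 1) * δ (toℕ i) (λ' * C + λ' * x + 2)) ⟩
    (∑[ i < M ] δ (toℕ i) (λ' * C + 1 + λ' * x)) + (∑[ i < M ] ((λ' * x ∸ 1) * δ (toℕ i) (λ' * C + λ' * x + 2)))
      ≡⟨ cong₂ _+_ (∑-δ M _ (<-trans (first<second x) second<M))
                   (sym (*-distribˡ-sum {M} (λ' * x ∸ 1) (λ i → δ (toℕ i) (λ' * C + λ' * x + 2)))) ⟩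
    1 + (λ' * x ∸ 1) * (∑[ i < M ] δ (toℕ i) (λ' * C + λ' * x + 2))
      ≡⟨ cong (λ c → 1 + (λ' * x ∸ 1) * c) (∑-δ M _ second<M) ⟩
    1 + (λ' * x ∸ 1) * 1
      ≡⟨ trans (cong (1 +_) (*-identityʳ (λ' * x ∸ 1))) (m+[n∸m]≡n λx≥1) ⟩
    λ' * x ∎
    where open ≡-Reasoning

  P-mass : (∀ j → 1 ≤ λ' * lookup a j) → (∀ j → lookup a j ≤ C) →
           ∀ M → λ' * C + λ' * C + 2 < M → ∑[ i < M ] P (toℕ i) ≡ n + λ' * sum a
  P-mass λa≥1 a≤C M bound<M = begin
    ∑[ i < M ] P (toℕ i)
      ≡⟨ sum-cong-≗ {M} (λ i → P-as-∑ (toℕ i)) ⟩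
    ∑[ i < M ] (n * δ (toℕ i) s + ∑[ j < m ] column (toℕ i) (lookup a j))
      ≡⟨ ∑-distrib-+ {M} (λ i → n * δ (toℕ i) s) (λ i → ∑[ j < m ] column (toℕ i) (lookup a j)) ⟩
    (∑[ i < M ] (n * δ (toℕ i) s)) + (∑[ i < M ] ∑[ j < m ] column (toℕ i) (lookup a j))
      ≡⟨ cong₂ _+_ root-terms (∑-comm {M} {m} (λ i j → column (toℕ i) (lookup a j))) ⟩
    n + (∑[ j < m ] ∑[ i < M ] column (toℕ i) (lookup a j))
      ≡⟨ cong (n +_) (sum-cong-≗ {m} (λ j → ∑-column M (lookup a j) (λa≥1 j) (second<M j))) ⟩
    n + (∑[ j < m ] (λ' * lookup a j))
      ≡⟨ cong (n +_) (*-distribˡ-sum {m} λ' (lookup a)) ⟨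
    n + λ' * (∑[ j < m ] lookup a j)
      ≡⟨ cong (λ t → n + λ' * t) (trans (cong sum (sym (map-id a))) (sum-map≡∑ (λ x → x) a)) ⟨
    n + λ' * sum a ∎
    where
    open ≡-Reasoning
    root-terms : ∑[ i < M ] (n * δ (toℕ i) s) ≡ n
    root-terms = begin
      ∑[ i < M ] (n * δ (toℕ i) s)  ≡⟨ *-distribˡ-sum {M} n (λ i → δ (toℕ i) s) ⟨
      n * (∑[ i < M ] δ (toℕ i) s)  ≡⟨ cong (n *_) (∑-δ M s (<-trans (s<second C) bound<M)) ⟩
      n * 1                         ≡⟨ *-identityʳ n ⟩
      n                             ∎
    second<M : ∀ j → λ' * C + λ' * lookup a j + 2 < M
    second<M j = ≤-<-trans (+-monoˡ-≤ 2 (+-monoʳ-≤ (λ' * C) (*-monoʳ-≤ λ' (a≤C j)))) bound<M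

mutual
  length-labelsFrom : ∀ μ t → length (labelsFrom μ t) ≡ size t
  length-labelsFrom μ (node ts) = cong suc (length-labelsChildren μ ts)

  length-labelsChildren : ∀ μ ts → length (labelsChildren μ ts) ≡ sizes ts
  length-labelsChildren μ [] = refl
  length-labelsChildren μ (t ∷ ts) =
    trans (length-++ (labelsFrom (childLabel μ t) t))
          (cong₂ _+_ (length-labelsFrom (childLabel μ t) t) (length-labelsChildren μ ts))

sizes≡sum-childLabels : ∀ ts → sizes ts ≡ listSum (map (childLabel 0) ts)
sizes≡sum-childLabels [] = refl
sizes≡sum-childLabels (t ∷ ts) = cong (size t +_) (sizes≡sum-childLabels ts)

mutual
  labelsFrom-≥ : ∀ μ t → All (μ ≤_) (labelsFrom μ t)
  labelsFrom-≥ μ (node ts) = ≤-refl ∷ All.map <⇒≤ (labelsChildren-> μ ts)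

  labelsChildren-> : ∀ μ ts → All (μ <_) (labelsChildren μ ts)
  labelsChildren-> μ [] = []
  labelsChildren-> μ (node us ∷ ts) =
    ++⁺ (All.map (<-≤-trans (m<m+n μ (s≤s z≤n))) (labelsFrom-≥ (childLabel μ (node us)) (node us)))
        (labelsChildren-> μ ts)

childLabels⊆labels : ∀ {P : ℕ → Set} μ ts → All P (labelsChildren μ ts) → All P (map (childLabel μ) ts)
childLabels⊆labels μ [] [] = []
childLabels⊆labels μ (t@(node _) ∷ ts) P-labels =
  All.head (++⁻ˡ (labelsFrom (childLabel μ t) t) P-labels)
  ∷ childLabels⊆labels μ ts (++⁻ʳ (labelsFrom (childLabel μ t) t) P-labels)

-- A label k that is at most every child label occurs only at children: deeper
-- vertices carry strictly larger labels.
countOf-labelsChildren : ∀ k μ ts → All (k ≤_) (map (childLabel μ) ts) →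
                         countOf k (labelsChildren μ ts) ≡ countOf k (map (childLabel μ) ts)
countOf-labelsChildren k μ [] [] = refl
countOf-labelsChildren k μ (node us ∷ ts) (k≤ℓ ∷ k≤ℓs) = begin
  countOf k ((ℓ ∷ deeper) ++ labelsChildren μ ts)
    ≡⟨ countOf-++ k (ℓ ∷ deeper) (labelsChildren μ ts) ⟩
  countOf k (ℓ ∷ deeper) + countOf k (labelsChildren μ ts)
    ≡⟨ cong₂ _+_ (countOf-∷ k ℓ deeper) (countOf-labelsChildren k μ ts k≤ℓs) ⟩
  δ ℓ k + countOf k deeper + countOf k (map (childLabel μ) ts)
    ≡⟨ cong (λ c → δ ℓ k + c + countOf k (map (childLabel μ) ts)) no-deeper ⟩
  δ ℓ k + 0 + countOf k (map (childLabel μ) ts)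
    ≡⟨ trans (cong (_+ countOf k (map (childLabel μ) ts)) (+-identityʳ (δ ℓ k))) (sym (countOf-∷ k ℓ _)) ⟩
  countOf k (ℓ ∷ map (childLabel μ) ts) ∎
  where
  open ≡-Reasoning
  ℓ : ℕ
  ℓ = childLabel μ (node us)
  deeper : List ℕ
  deeper = labelsChildren ℓ us
  no-deeper : countOf k deeper ≡ 0
  no-deeper = countOf-above k deeper (All.map (≤-<-trans k≤ℓ) (labelsChildren-> ℓ us))

length-by-counts : ∀ M xs (p : ℕ → ℕ) → All (_< M) xs → (∀ i → countOf i xs ≡ p i) →
                   length xs ≡ ∑[ i < M ] p (toℕ i)
length-by-counts M xs p xs<M counts = trans (sym (∑-countOf M xs xs<M)) (sum-cong-≗ {M} (λ i → counts (toℕ i)))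

below-sum : ∀ k xs → All (_< suc (listSum xs + k)) xs
below-sum k xs = All.tabulate (λ x∈xs → s≤s (≤-trans (∈⇒≤sum x∈xs) (m≤m+n _ k)))

root-children-forced : ∀ ts s k → let R = labelsChildren 0 ts in
                       (∀ i → i < s → countOf i R ≡ 0) → countOf s R ≡ k → length R ≡ k * s →
                       length ts ≡ k × All (_≡ s) (map (childLabel 0) ts)
root-children-forced ts s k no-small-labels count-s length-R = length-ts , ℓs≡s
  where
  R ℓs : List ℕ
  R = labelsChildren 0 ts
  ℓs = map (childLabel 0) ts

  ℓs≥s : All (s ≤_) ℓs
  ℓs≥s = childLabels⊆labels 0 ts (lower-bound-from-counts s R no-small-labels)

  count-ℓs : countOf s ℓs ≡ k
  count-ℓs = trans (sym (countOf-labelsChildren s 0 ts ℓs≥s)) count-s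

  sum-ℓs : listSum ℓs ≡ countOf s ℓs * s
  sum-ℓs = begin
    listSum ℓs       ≡⟨ trans (length-labelsChildren 0 ts) (sizes≡sum-childLabels ts) ⟨
    length R         ≡⟨ length-R ⟩
    k * s            ≡⟨ cong (_* s) count-ℓs ⟨
    countOf s ℓs * s ∎
    where open ≡-Reasoning

  ℓs≡s : All (_≡ s) ℓs
  ℓs≡s = all-equal-if-sum-tight s ℓs ℓs≥s (≤-reflexive sum-ℓs)

  length-ts : length ts ≡ k
  length-ts = trans (sym (length-map (childLabel 0) ts)) (trans (sym (countOf-const s ℓs ℓs≡s)) count-ℓs)

lemma2 : (n C : ℕ) → 1 ≤ n → (a : Vec ℕ (3 * n)) →
         (∀ (i : Fin (3 * n)) → C < 4 * lookup a i) →
         (∀ (i : Fin (3 * n)) → 2 * lookup a i < C) →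
         sum a ≡ n * C →
         (λ' : ℕ) → 1 ≤ λ' →
         (T : Tree) → (∀ (i : ℕ) → avCoeff T i ≡ PCoeff n C λ' a i) →
         (length (children T) ≡ n)
           × All (λ l → l ≡ λ' * C + 1) (map (childLabel 0) (children T))
lemma2 n C _ a C<4a 2a<C sum-a λ' λ'≥1 (node ts) Av≡P =
  root-children-forced ts s n (λ i i<s → trans (count-R i) (P-below i i<s)) (trans (count-R s) (P-at-s λa≥1)) length-R
  where
  open Coefficients n C λ' a
  R : List ℕ
  R = labelsChildren 0 ts

  λa≥1 : ∀ j → 1 ≤ λ' * lookup a j
  λa≥1 j = *-mono-≤ λ'≥1 (positive (lookup a j) (C<4a j))
    where
    positive : ∀ y → C < 4 * y → 1 ≤ y
    positive zero C<0 = contradiction C<0 n≮0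
    positive (suc _) _ = s≤s z≤n

  a≤C : ∀ j → lookup a j ≤ C
  a≤C j = <⇒≤ (≤-<-trans (m≤m+n (lookup a j) _) (2a<C j))

  count-R : ∀ i → countOf i R ≡ P i
  count-R zero = trans (countOf-above 0 R (labelsChildren-> 0 ts)) (sym (P-below 0 (m≤n+m 1 (λ' * C))))
  count-R (suc i) = Av≡P (suc i)

  length-R : length R ≡ n * s
  length-R = begin
    length R             ≡⟨ length-by-counts M R P (below-sum bound R) count-R ⟩
    ∑[ i < M ] P (toℕ i) ≡⟨ P-mass λa≥1 a≤C M (s≤s (m≤n+m bound (listSum R))) ⟩
    n + λ' * sum a       ≡⟨ cong (λ t → n + λ' * t) sum-a ⟩
    n + λ' * (n * C)     ≡⟨ solve 3 (λ n l c → n :+ l :* (n :* c) := n :* (l :* c :+ con 1)) refl n λ' C ⟩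
    n * s                ∎
    where
    open ≡-Reasoning
    open +-*-Solver
    bound M : ℕ
    bound = λ' * C + λ' * C + 2
    M = suc (listSum R + bound)
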